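{- Let $G$ be a finite simple graph of order $n\ge 1$ and let $r>0$ be an integer. Then $$DP(G\circ \overline{K}_r,x)=x+2^{n-1}x^2.$$
   Context: $G\circ\overline{K}_r$ is the corona of $G$ with the edgeless graph on $r$ vertices, i.e. the graph obtained from $G$ by attaching $r$ new pendant vertices to each vertex of $G$. A dominating set of a graph $H$ is a set $S\subseteq V(H)$ such that every vertex outside $S$ has a neighbor in $S$. A domatic partition is a partition of $V(H)$ into nonempty dominating sets; $d(H)$ is the maximum number of parts of one; $dp(H,i)$ is the number of distinct unordered domatic partitions with exactly $i$ parts; and $DP(H,x)=\sum_{i=1}^{d(H)}dp(H,i)x^i$. -}

module Defs where

open import Data.Nat using (ℕ; zero; suc; _+_; _*_; _∸_; _^_; _!; _/_)
open import Data.Nat.Properties using (_!≢0)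
open import Data.Bool using (Bool; true; false; _∧_; _∨_; if_then_else_)
open import Data.Fin using (Fin; zero; suc; remQuot; _≟_)
open import Data.Product using (_×_; _,_)
open import Data.List using (List; []; _∷_; length; filter; concatMap; map)
open import Data.List using () renaming (allFin to finList)
open import Relation.Nullary using (does)
open import Relation.Binary.PropositionalEquality using (_≡_)

allF : ∀ {m} → (Fin m → Bool) → Bool
allF {zero}  p = true
allF {suc m} p = p zero ∧ allF (λ i → p (suc i))

anyF : ∀ {m} → (Fin m → Bool) → Bool
anyF {zero}  p = false
anyF {suc m} p = p zero ∨ anyF (λ i → p (suc i))

_=ᶠ_ : ∀ {m} → Fin m → Fin m → Bool
i =ᶠ j = does (i ≟ j)

record SimpleGraph (n : ℕ) : Set where
  field
    adj    : Fin n → Fin n → Bool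
    sym    : ∀ u v → adj u v ≡ adj v u
    irrefl : ∀ v → adj v v ≡ false
open SimpleGraph public

-- Corona G ∘ K̄_r.  Vertex set Fin (n * suc r) ≅ Fin n × Fin (suc r) (via remQuot):
-- (v , zero) is the original vertex v of G, (v , suc k) is the k-th pendant vertex attached to v.
coronaAdj : ∀ {n} (r : ℕ) → (Fin n → Fin n → Bool) → Fin (n * suc r) → Fin (n * suc r) → Bool
coronaAdj {n} r a x y with remQuot {n} (suc r) x | remQuot {n} (suc r) y
... | v , zero  | w , zero  = a v w
... | v , zero  | w , suc _ = v =ᶠ w
... | v , suc _ | w , zero  = v =ᶠ w
... | v , suc _ | w , suc _ = false

allFuns : (m i : ℕ) → List (Fin m → Fin i)
allFuns zero    i = (λ ()) ∷ []
allFuns (suc m) i = concatMap (λ f → map (λ c → cons c f) (finList i)) (allFuns m i)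
  where
  cons : Fin i → (Fin m → Fin i) → Fin (suc m) → Fin i
  cons c f zero    = c
  cons c f (suc k) = f k

isDominating : ∀ {m} → (Fin m → Fin m → Bool) → (Fin m → Bool) → Bool
isDominating adjH D = allF (λ v → D v ∨ anyF (λ u → adjH v u ∧ D u))

isDomaticLabelling : ∀ {m i} → (Fin m → Fin m → Bool) → (Fin m → Fin i) → Bool
isDomaticLabelling adjH f =
  allF (λ j → anyF (λ v → f v =ᶠ j) ∧ isDominating adjH (λ v → f v =ᶠ j))

orderedDomatic : (m : ℕ) → (Fin m → Fin m → Bool) → ℕ → ℕ
orderedDomatic m adjH i = length (filter (λ f → isDomaticLabelling adjH f ≟ᵇ true) (allFuns m i))
  where
  open import Data.Bool.Properties using () renaming (_≟_ to _≟ᵇ_)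

-- dp(H,i): number of unordered domatic partitions with exactly i parts.
-- Each unordered partition into i nonempty parts has exactly i! labellings.
dp : (m : ℕ) → (Fin m → Fin m → Bool) → ℕ → ℕ
dp m adjH i = _/_ (orderedDomatic m adjH i) (i !) {{i !≢0}}

rhsCoeff : ℕ → ℕ → ℕ
rhsCoeff n 1 = 1
rhsCoeff n 2 = 2 ^ (n ∸ 1)
rhsCoeff n _ = 0

{-# OPTIONS --safe #-}
-- Each pendant vertex p of G ∘ K̄_r attached to v has closed neighbourhood {p, v}, and every
-- part of a domatic partition must meet it: so there are at most two parts, and a labelling
-- by two parts is domatic exactly when every pendant vertex carries the label opposite to
-- that of its root (then every vertex has a neighbour in the other part).  Such labellings
-- are fixed by the labels of the n roots, giving 2^n ordered and 2^(n-1) unordered domatic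
-- partitions into two parts; the partition into one part is always domatic.
module Submission where

open import Defs hiding (sym)
open import Data.Nat using (ℕ; _*_; suc; _≤_; _<_; zero; _+_; _^_; _/_; _!; z≤n; s≤s)
open import Relation.Binary.PropositionalEquality
  using (_≡_; _≢_; refl; sym; trans; cong; cong₂; subst; _≗_; module ≡-Reasoning)

open import Data.Bool using (Bool; true; false; T; _∧_; _∨_)
open import Data.Bool.Properties using (T-∧; T-∨) renaming (_≟_ to _≟ᵇ_)
open import Data.Empty using (⊥-elim)
open import Data.Fin using (Fin; zero; suc; combine; remQuot; opposite; _↑ˡ_; _↑ʳ_; _≟_)
open import Data.Fin.Properties using (¬Fin0; combine-remQuot; remQuot-combine; opposite-involutive)
open import Data.List using (List; []; _∷_; _++_; map; filter; length; concatMap; allFin)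
open import Data.List.Properties using (map-++; map-∘; map-cong; map-tabulate; length-tabulate)
open import Data.Nat.DivMod using (0/n≡0; m*n/n≡m)
open import Data.Nat.ListAction using (sum)
open import Data.Nat.ListAction.Properties using (sum-++)
open import Data.Nat.Properties
  using (+-identityʳ; *-identityʳ; *-zeroʳ; *-assoc; *-comm; *-distribˡ-+; *-distribʳ-+; ^-zeroˡ; _!≢0;
         +-commutativeSemigroup)
open import Algebra.Properties.CommutativeSemigroup +-commutativeSemigroup using (interchange)
open import Data.Product using (_×_; _,_; proj₁; proj₂; ∃-syntax; uncurry)
open import Data.Sum using (_⊎_; inj₁; inj₂)
import Data.Sum as Sum
open import Data.Unit using (tt)
open import Data.Vec.Functional using (take; drop) renaming (_∷_ to _∷ᶠ_)
open import Function using (_∘_; const; id; _⇔_; mk⇔; Equivalence)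
open import Relation.Binary using (_Preserves_⟶_)
open import Relation.Nullary using (¬_; yes; no)
open import Relation.Nullary.Reflects using (fromEquivalence; T-reflects-elim)

open Equivalence using (to; from)
open ≡-Reasoning

T-injective : ∀ {a b} → T a ⇔ T b → a ≡ b
T-injective a⇔b = T-reflects-elim (fromEquivalence (to a⇔b) (from a⇔b))

T-=ᶠ : ∀ {m} {i j : Fin m} → T (i =ᶠ j) ⇔ i ≡ j
T-=ᶠ {i = i} {j} with i ≟ j
... | yes i≡j = mk⇔ (const i≡j) (const tt)
... | no i≢j  = mk⇔ (λ ()) i≢j

T-allF : ∀ {m} {p : Fin m → Bool} → T (allF p) ⇔ (∀ x → T (p x))
T-allF {zero}  = mk⇔ (λ _ ()) (const tt)
T-allF {suc m} = mk⇔
  (λ t → λ { zero → proj₁ (to T-∧ t) ; (suc x) → to T-allF (proj₂ (to T-∧ t)) x })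
  (λ h → from T-∧ (h zero , from T-allF (h ∘ suc)))

T-anyF : ∀ {m} {p : Fin m → Bool} → T (anyF p) ⇔ (∃[ x ] T (p x))
T-anyF {zero}  = mk⇔ (λ ()) (λ ())
T-anyF {suc m} {p} = mk⇔ witness
  (λ { (zero , p0) → from T-∨ (inj₁ p0) ; (suc x , px) → from T-∨ (inj₂ (from T-anyF (x , px))) })
  where
  witness : T (anyF p) → ∃[ x ] T (p x)
  witness t with to T-∨ t
  ... | inj₁ p0 = zero , p0
  ... | inj₂ t′ = let x , px = to T-anyF t′ in suc x , px

allF-cong : ∀ {m} {p q : Fin m → Bool} → p ≗ q → allF p ≡ allF q
allF-cong p≗q = T-injective (mk⇔ (λ t → from T-allF λ x → subst T (p≗q x) (to T-allF t x))
                                 (λ t → from T-allF λ x → subst T (sym (p≗q x)) (to T-allF t x)))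

indicator : Bool → ℕ
indicator true  = 1
indicator false = 0

indicator-∧ : ∀ a b → indicator (a ∧ b) ≡ indicator a * indicator b
indicator-∧ true  b = sym (+-identityʳ (indicator b))
indicator-∧ false b = refl

indicator-¬T : ∀ {b} → ¬ T b → indicator b ≡ 0
indicator-¬T {true}  ¬t = ⊥-elim (¬t tt)
indicator-¬T {false} _  = refl

indicator-T : ∀ {b} → T b → indicator b ≡ 1
indicator-T {true} _ = refl

length-filter-≡true : ∀ {A : Set} (P : A → Bool) xs →
  length (filter (λ x → P x ≟ᵇ true) xs) ≡ sum (map (indicator ∘ P) xs)
length-filter-≡true P []       = refl
length-filter-≡true P (x ∷ xs) with P x
... | true  = cong suc (length-filter-≡true P xs)
... | false = length-filter-≡true P xs

module _ {A : Set} where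

  sum-map-+ : ∀ (f g : A → ℕ) xs → sum (map (λ x → f x + g x) xs) ≡ sum (map f xs) + sum (map g xs)
  sum-map-+ f g []       = refl
  sum-map-+ f g (x ∷ xs) = trans (cong (f x + g x +_) (sum-map-+ f g xs))
                                 (interchange (f x) (g x) (sum (map f xs)) (sum (map g xs)))

  sum-map-*ˡ : ∀ k (f : A → ℕ) xs → sum (map (λ x → k * f x) xs) ≡ k * sum (map f xs)
  sum-map-*ˡ k f []       = sym (*-zeroʳ k)
  sum-map-*ˡ k f (x ∷ xs) = trans (cong (k * f x +_) (sum-map-*ˡ k f xs))
                                  (sym (*-distribˡ-+ k (f x) (sum (map f xs))))

  sum-map-*ʳ : ∀ k (f : A → ℕ) xs → sum (map (λ x → f x * k) xs) ≡ sum (map f xs) * k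
  sum-map-*ʳ k f []       = refl
  sum-map-*ʳ k f (x ∷ xs) = trans (cong (f x * k +_) (sum-map-*ʳ k f xs))
                                  (sym (*-distribʳ-+ k (f x) (sum (map f xs))))

  sum-map-const : ∀ c (xs : List A) → sum (map (const c) xs) ≡ length xs * c
  sum-map-const c []       = refl
  sum-map-const c (x ∷ xs) = cong (c +_) (sum-map-const c xs)

  sum-map-concatMap : ∀ {B : Set} (w : B → ℕ) (g : A → List B) xs →
    sum (map w (concatMap g xs)) ≡ sum (map (λ x → sum (map w (g x))) xs)
  sum-map-concatMap w g []       = refl
  sum-map-concatMap w g (x ∷ xs) = begin
    sum (map w (g x ++ concatMap g xs))
      ≡⟨ cong sum (map-++ w (g x) (concatMap g xs)) ⟩
    sum (map w (g x) ++ map w (concatMap g xs))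
      ≡⟨ sum-++ (map w (g x)) _ ⟩
    sum (map w (g x)) + sum (map w (concatMap g xs))
      ≡⟨ cong (sum (map w (g x)) +_) (sum-map-concatMap w g xs) ⟩
    sum (map w (g x)) + sum (map (λ x → sum (map w (g x))) xs) ∎

sum-map-allFin-suc : ∀ {i} (g : Fin (suc i) → ℕ) →
  sum (map g (allFin (suc i))) ≡ g zero + sum (map (g ∘ suc) (allFin i))
sum-map-allFin-suc g = cong (g zero +_) (cong sum (trans (map-tabulate suc g) (sym (map-tabulate id (g ∘ suc)))))

sum-indicator-=ᶠ-∧ : ∀ {i} (c : Fin i) b →
  sum (map (λ c′ → indicator ((c′ =ᶠ c) ∧ b)) (allFin i)) ≡ indicator b
sum-indicator-=ᶠ-∧ {suc i} zero b =
  trans (sum-map-allFin-suc {i} (λ c′ → indicator ((c′ =ᶠ zero) ∧ b)))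
  (trans (cong (indicator b +_) (trans (sum-map-const 0 (allFin i)) (*-zeroʳ (length (allFin i))))) (+-identityʳ _))
sum-indicator-=ᶠ-∧ {suc i} (suc c) b =
  trans (sum-map-allFin-suc {i} (λ c′ → indicator ((c′ =ᶠ suc c) ∧ b))) (sum-indicator-=ᶠ-∧ c b)

sumFuns : ∀ m i → ((Fin m → Fin i) → ℕ) → ℕ
sumFuns m i w = sum (map w (allFuns m i))

-- Without function extensionality, a weight must respect pointwise equality for it to
-- be summed over the functions that 'allFuns' builds with its own cons operation.
Extensional : ∀ {m i} {B : Set} → ((Fin m → Fin i) → B) → Set
Extensional w = w Preserves _≗_ ⟶ _≡_

module _ {m i : ℕ} where

  sumFuns-cong : ∀ {u v : (Fin m → Fin i) → ℕ} → u ≗ v → sumFuns m i u ≡ sumFuns m i v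
  sumFuns-cong u≗v = cong sum (map-cong u≗v (allFuns m i))

  sumFuns-+ : ∀ (u v : (Fin m → Fin i) → ℕ) →
    sumFuns m i (λ f → u f + v f) ≡ sumFuns m i u + sumFuns m i v
  sumFuns-+ u v = sum-map-+ u v (allFuns m i)

  sumFuns-suc : ∀ (w : (Fin (suc m) → Fin i) → ℕ) → Extensional w →
    sumFuns (suc m) i w ≡ sumFuns m i (λ f → sum (map (λ c → w (c ∷ᶠ f)) (allFin i)))
  sumFuns-suc w w-ext = trans (sum-map-concatMap w _ (allFuns m i)) (sumFuns-cong λ f →
    cong sum (trans (sym (map-∘ (allFin i)))
                    (map-cong (λ c → w-ext λ { zero → refl ; (suc k) → refl }) (allFin i))))

sumFuns-zero : ∀ {i} (u : (Fin 0 → Fin i) → ℕ) → Extensional u → ∀ g → sumFuns 0 i u ≡ u g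
sumFuns-zero u u-ext g = trans (+-identityʳ _) (u-ext λ ())

sumFuns-const : ∀ m {i} c → sumFuns m i (const c) ≡ i ^ m * c
sumFuns-const zero    c = refl
sumFuns-const (suc m) {i} c = begin
  sumFuns (suc m) i (const c)                          ≡⟨ sumFuns-suc {m} (const c) (const refl) ⟩
  sumFuns m i (const (sum (map (const c) (allFin i)))) ≡⟨ sumFuns-const m _ ⟩
  i ^ m * sum (map (const c) (allFin i))               ≡⟨ cong (i ^ m *_) (sum-map-const c (allFin i)) ⟩
  i ^ m * (length (allFin i) * c)                      ≡⟨ cong (λ l → i ^ m * (l * c)) (length-tabulate {n = i} id) ⟩
  i ^ m * (i * c)                                      ≡⟨ sym (*-assoc (i ^ m) i c) ⟩
  i ^ m * i * c                                        ≡⟨ cong (_* c) (*-comm (i ^ m) i) ⟩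
  i * i ^ m * c                                        ∎

sumFuns-take-drop : ∀ a {b i} (u : (Fin a → Fin i) → ℕ) (v : (Fin b → Fin i) → ℕ) →
  Extensional u → Extensional v →
  sumFuns (a + b) i (λ f → u (take a f) * v (drop a f)) ≡ sumFuns a i u * sumFuns b i v
sumFuns-take-drop zero {b} {i} u v u-ext _ =
  trans (sumFuns-cong {b} {i} λ f → cong (_* v f) (sym (sumFuns-zero u u-ext (take 0 f))))
        (sum-map-*ˡ (sumFuns 0 i u) v (allFuns b i))
sumFuns-take-drop (suc a) {b} {i} u v u-ext v-ext = begin
  sumFuns (suc a + b) i (λ f → u (take (suc a) f) * v (drop (suc a) f))
    ≡⟨ sumFuns-suc {a + b} _ (λ f≗g → cong₂ _*_ (u-ext (f≗g ∘ (_↑ˡ b))) (v-ext (f≗g ∘ (suc a ↑ʳ_)))) ⟩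
  sumFuns (a + b) i (λ f → sum (map (λ c → u (take (suc a) (c ∷ᶠ f)) * v (drop a f)) (allFin i)))
    ≡⟨ sumFuns-cong {a + b} (λ f →
         trans (cong sum (map-cong (λ c → cong (_* v (drop a f)) (u-ext (take-∷ᶠ c f))) (allFin i)))
               (sum-map-*ʳ (v (drop a f)) _ (allFin i))) ⟩
  sumFuns (a + b) i (λ f → u′ (take a f) * v (drop a f))
    ≡⟨ sumFuns-take-drop a u′ v u′-ext v-ext ⟩
  sumFuns a i u′ * sumFuns b i v
    ≡⟨ cong (_* sumFuns b i v) (sym (sumFuns-suc u u-ext)) ⟩
  sumFuns (suc a) i u * sumFuns b i v ∎
  where
  u′ : (Fin a → Fin i) → ℕ
  u′ g = sum (map (λ c → u (c ∷ᶠ g)) (allFin i))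

  u′-ext : Extensional u′
  u′-ext g≗h = cong sum (map-cong (λ c → u-ext λ { zero → refl ; (suc k) → g≗h k }) (allFin i))

  take-∷ᶠ : ∀ c f → take (suc a) (c ∷ᶠ f) ≗ c ∷ᶠ take a f
  take-∷ᶠ c f zero    = refl
  take-∷ᶠ c f (suc k) = refl

sumFuns-blockwise : ∀ {s i} (q : (Fin s → Fin i) → Bool) → Extensional q → ∀ N →
  sumFuns (N * s) i (λ f → indicator (allF {N} (λ v → q (λ k → f (combine v k)))))
    ≡ sumFuns s i (indicator ∘ q) ^ N
sumFuns-blockwise q q-ext zero = refl
sumFuns-blockwise {s} {i} q q-ext (suc N) = begin
  sumFuns (s + N * s) i (λ f → indicator (q (take s f) ∧ blocks (drop s f)))
    ≡⟨ sumFuns-cong {s + N * s} (λ f → indicator-∧ (q (take s f)) _) ⟩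
  sumFuns (s + N * s) i (λ f → indicator (q (take s f)) * indicator (blocks (drop s f)))
    ≡⟨ sumFuns-take-drop s _ _ (cong indicator ∘ q-ext) (cong indicator ∘ blocks-ext) ⟩
  sumFuns s i (indicator ∘ q) * sumFuns (N * s) i (indicator ∘ blocks)
    ≡⟨ cong (sumFuns s i (indicator ∘ q) *_) (sumFuns-blockwise q q-ext N) ⟩
  sumFuns s i (indicator ∘ q) ^ suc N ∎
  where
  blocks : (Fin (N * s) → Fin i) → Bool
  blocks g = allF {N} (λ v → q (λ k → g (combine v k)))

  blocks-ext : Extensional blocks
  blocks-ext g≗h = allF-cong {N} (λ v → q-ext (λ k → g≗h (combine v k)))

sumFuns-indicator-const : ∀ m {i} (c : Fin i) → sumFuns m i (λ h → indicator (allF (λ k → h k =ᶠ c))) ≡ 1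
sumFuns-indicator-const zero    c = refl
sumFuns-indicator-const (suc m) {i} c = begin
  sumFuns (suc m) i (λ h → indicator (allF (λ k → h k =ᶠ c)))
    ≡⟨ sumFuns-suc {m} _ (λ g≗h → cong indicator (allF-cong (λ k → cong (_=ᶠ c) (g≗h k)))) ⟩
  sumFuns m i (λ h → sum (map (λ c′ → indicator ((c′ =ᶠ c) ∧ allF (λ k → h k =ᶠ c))) (allFin i)))
    ≡⟨ sumFuns-cong {m} (λ h → sum-indicator-=ᶠ-∧ c _) ⟩
  sumFuns m i (λ h → indicator (allF (λ k → h k =ᶠ c)))
    ≡⟨ sumFuns-indicator-const m c ⟩
  1 ∎

-- On Fin 2, 'opposite' exchanges the two labels.
separatesRoot : ∀ {r} → (Fin (suc r) → Fin 2) → Bool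
separatesRoot g = allF (λ k → g (suc k) =ᶠ opposite (g zero))

separatesRoot-ext : ∀ {r} → Extensional (separatesRoot {r})
separatesRoot-ext g≗h = allF-cong (λ k → cong₂ _=ᶠ_ (g≗h (suc k)) (cong opposite (g≗h zero)))

sumFuns-separatesRoot : ∀ r → sumFuns (suc r) 2 (indicator ∘ separatesRoot) ≡ 2
sumFuns-separatesRoot r = begin
  sumFuns (suc r) 2 (indicator ∘ separatesRoot)
    ≡⟨ sumFuns-suc {r} _ (cong indicator ∘ separatesRoot-ext) ⟩
  sumFuns r 2 (λ h → constantly (suc zero) h + (constantly zero h + 0))
    ≡⟨ sumFuns-cong {r} (λ h → cong (constantly (suc zero) h +_) (+-identityʳ _)) ⟩
  sumFuns r 2 (λ h → constantly (suc zero) h + constantly zero h)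
    ≡⟨ sumFuns-+ (constantly (suc zero)) (constantly zero) ⟩
  sumFuns r 2 (constantly (suc zero)) + sumFuns r 2 (constantly zero)
    ≡⟨ cong₂ _+_ (sumFuns-indicator-const r (suc zero)) (sumFuns-indicator-const r zero) ⟩
  2 ∎
  where
  constantly : Fin 2 → (Fin r → Fin 2) → ℕ
  constantly c h = indicator (allF (λ k → h k =ᶠ c))

covered-by-two⇒≤2 : ∀ {i} (a b : Fin i) → (∀ j → a ≡ j ⊎ b ≡ j) → i ≤ 2
covered-by-two⇒≤2 {0} _ _ _ = z≤n
covered-by-two⇒≤2 {1} _ _ _ = s≤s z≤n
covered-by-two⇒≤2 {2} _ _ _ = s≤s (s≤s z≤n)
covered-by-two⇒≤2 {suc (suc (suc _))} a b cover
  with cover zero | cover (suc zero) | cover (suc (suc zero))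
... | inj₁ refl | inj₁ ()   | _
... | inj₁ refl | inj₂ refl | inj₁ ()
... | inj₁ refl | inj₂ refl | inj₂ ()
... | inj₂ refl | inj₁ refl | inj₁ ()
... | inj₂ refl | inj₁ refl | inj₂ ()
... | inj₂ refl | inj₂ ()   | _

≡⊎opposite≡ : ∀ (a b : Fin 2) → a ≡ b ⊎ opposite a ≡ b
≡⊎opposite≡ zero       zero       = inj₁ refl
≡⊎opposite≡ zero       (suc zero) = inj₂ refl
≡⊎opposite≡ (suc zero) zero       = inj₂ refl
≡⊎opposite≡ (suc zero) (suc zero) = inj₁ refl

opposite-≢ : ∀ (a : Fin 2) → opposite a ≢ a
opposite-≢ zero       ()
opposite-≢ (suc zero) ()

record IsDomaticLabelling {m i} (A : Fin m → Fin m → Bool) (f : Fin m → Fin i) : Set where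
  field
    nonempty  : ∀ j → ∃[ x ] f x ≡ j
    dominated : ∀ j x → f x ≡ j ⊎ ∃[ y ] T (A x y) × f y ≡ j
open IsDomaticLabelling

T-isDomaticLabelling : ∀ {m i} {A : Fin m → Fin m → Bool} {f : Fin m → Fin i} →
  T (isDomaticLabelling A f) ⇔ IsDomaticLabelling A f
T-isDomaticLabelling {A = A} {f} = mk⇔ reflect unreflect
  where
  reflect : T (isDomaticLabelling A f) → IsDomaticLabelling A f
  reflect t = record
    { nonempty  = λ j → let x , fx = to T-anyF (proj₁ (part j)) in x , to (T-=ᶠ {i = f x}) fx
    ; dominated = λ j x → Sum.map (to (T-=ᶠ {i = f x})) (neighbour j x) (to T-∨ (to T-allF (proj₂ (part j)) x))
    }
    where
    part : ∀ j → T (anyF (λ x → f x =ᶠ j)) × T (isDominating A (λ x → f x =ᶠ j))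
    part j = to T-∧ (to T-allF t j)

    neighbour : ∀ j x → T (anyF (λ y → A x y ∧ (f y =ᶠ j))) → ∃[ y ] T (A x y) × f y ≡ j
    neighbour j x t′ = let y , xy-fy = to T-anyF t′ ; xy , fy = to T-∧ xy-fy in y , xy , to (T-=ᶠ {i = f y}) fy

  unreflect : IsDomaticLabelling A f → T (isDomaticLabelling A f)
  unreflect d = from T-allF λ j → from T-∧ (nonempty′ j , from T-allF (dominated′ j))
    where
    nonempty′ : ∀ j → T (anyF (λ x → f x =ᶠ j))
    nonempty′ j = let x , fx = nonempty d j in from T-anyF (x , from (T-=ᶠ {i = f x}) fx)

    dominated′ : ∀ j x → T ((f x =ᶠ j) ∨ anyF (λ y → A x y ∧ (f y =ᶠ j)))
    dominated′ j x with dominated d j x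
    ... | inj₁ fx           = from T-∨ (inj₁ (from (T-=ᶠ {i = f x}) fx))
    ... | inj₂ (y , xy , fy) = from T-∨ (inj₂ (from T-anyF (y , from T-∧ (xy , from (T-=ᶠ {i = f y}) fy))))

OnlyNeighbour : ∀ {m} → (Fin m → Fin m → Bool) → Fin m → Fin m → Set
OnlyNeighbour A p w = ∀ y → T (A p y) → y ≡ w

module _ {m i} {A : Fin m → Fin m → Bool} {f : Fin m → Fin i} (d : IsDomaticLabelling A f) where

  onlyNeighbour-labels : ∀ {p w} → OnlyNeighbour A p w → ∀ j → f p ≡ j ⊎ f w ≡ j
  onlyNeighbour-labels {p} p-only-w j =
    Sum.map₂ (λ (y , py , fy) → subst (λ z → f z ≡ j) (p-only-w y py) fy) (dominated d j p)

  onlyNeighbour⇒labels≤2 : ∀ {p w} → OnlyNeighbour A p w → i ≤ 2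
  onlyNeighbour⇒labels≤2 {p} {w} p-only-w = covered-by-two⇒≤2 (f p) (f w) (onlyNeighbour-labels p-only-w)

onlyNeighbour⇒opposite : ∀ {m} {A : Fin m → Fin m → Bool} {f : Fin m → Fin 2} {p w} →
  IsDomaticLabelling A f → OnlyNeighbour A p w → f p ≡ opposite (f w)
onlyNeighbour⇒opposite {f = f} {w = w} d p-only-w with onlyNeighbour-labels d p-only-w (opposite (f w))
... | inj₁ fp≡ = fp≡
... | inj₂ fw≡ = ⊥-elim (opposite-≢ (f w) (sym fw≡))

oppositeNeighbours⇒IsDomaticLabelling : ∀ {m} {A : Fin m → Fin m → Bool} {f : Fin m → Fin 2} → Fin m →
  (∀ x → ∃[ y ] T (A x y) × f y ≡ opposite (f x)) → IsDomaticLabelling A f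
oppositeNeighbours⇒IsDomaticLabelling {f = f} x₀ neighbour = record
  { nonempty  = λ j → Sum.[ (λ fx₀≡j → x₀ , fx₀≡j)
                          , (λ eq → let y , _ , fy = neighbour x₀ in y , trans fy eq)
                          ]′ (≡⊎opposite≡ (f x₀) j)
  ; dominated = λ j x → Sum.map₂ (λ eq → let y , xy , fy = neighbour x in y , xy , trans fy eq)
                                 (≡⊎opposite≡ (f x) j)
  }

singlePart-IsDomaticLabelling : ∀ {m} {A : Fin m → Fin m → Bool} → Fin m →
  (f : Fin m → Fin 1) → IsDomaticLabelling A f
singlePart-IsDomaticLabelling x₀ f = record
  { nonempty  = λ j → x₀ , Fin1-≡ (f x₀) j
  ; dominated = λ j x → inj₁ (Fin1-≡ (f x) j)
  }
  where
  Fin1-≡ : ∀ (a b : Fin 1) → a ≡ b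
  Fin1-≡ zero zero = refl

∀-combine : ∀ {n} k {P : Fin (n * k) → Set} → (∀ (v : Fin n) (t : Fin k) → P (combine v t)) → ∀ x → P x
∀-combine {n} k {P} P-combine x = subst P (combine-remQuot {n} k x) (uncurry P-combine (remQuot {n} k x))

orderedDomatic≡sumFuns : ∀ m (A : Fin m → Fin m → Bool) i →
  orderedDomatic m A i ≡ sumFuns m i (indicator ∘ isDomaticLabelling A)
orderedDomatic≡sumFuns m A i = length-filter-≡true (isDomaticLabelling A) (allFuns m i)

module _ {m} {A : Fin m → Fin m → Bool} where

  orderedDomatic-none : ∀ {i} → (∀ (f : Fin m → Fin i) → ¬ IsDomaticLabelling A f) →
    orderedDomatic m A i ≡ 0
  orderedDomatic-none {i} ¬d = begin
    orderedDomatic m A i                           ≡⟨ orderedDomatic≡sumFuns m A i ⟩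
    sumFuns m i (indicator ∘ isDomaticLabelling A) ≡⟨ sumFuns-cong (λ f → indicator-¬T (¬d f ∘ to T-isDomaticLabelling)) ⟩
    sumFuns m i (const 0)                          ≡⟨ sumFuns-const m 0 ⟩
    i ^ m * 0                                      ≡⟨ *-zeroʳ (i ^ m) ⟩
    0                                              ∎

  orderedDomatic-all : ∀ {i} → (∀ (f : Fin m → Fin i) → IsDomaticLabelling A f) →
    orderedDomatic m A i ≡ i ^ m
  orderedDomatic-all {i} d = begin
    orderedDomatic m A i                           ≡⟨ orderedDomatic≡sumFuns m A i ⟩
    sumFuns m i (indicator ∘ isDomaticLabelling A) ≡⟨ sumFuns-cong (λ f → indicator-T (from T-isDomaticLabelling (d f))) ⟩
    sumFuns m i (const 1)                          ≡⟨ sumFuns-const m 1 ⟩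
    i ^ m * 1                                      ≡⟨ *-identityʳ (i ^ m) ⟩
    i ^ m                                          ∎

  dp-none : ∀ {i} → (∀ (f : Fin m → Fin i) → ¬ IsDomaticLabelling A f) → dp m A i ≡ 0
  dp-none {i} ¬d = trans (cong (λ k → _/_ k (i !) {{i !≢0}}) (orderedDomatic-none ¬d)) (0/n≡0 (i !) {{i !≢0}})

module Corona {n : ℕ} (r : ℕ) (a : Fin n → Fin n → Bool) where

  H : Fin (n * suc r) → Fin (n * suc r) → Bool
  H = coronaAdj r a

  root : Fin n → Fin (n * suc r)
  root v = combine v zero

  pendant : Fin n → Fin r → Fin (n * suc r)
  pendant v k = combine v (suc k)

  root-adj-pendant : ∀ v k → T (H (root v) (pendant v k))
  root-adj-pendant v k rewrite remQuot-combine {n} {suc r} v zero | remQuot-combine {n} {suc r} v (suc k) =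
    from (T-=ᶠ {i = v}) refl

  pendant-adj-root : ∀ v k → T (H (pendant v k) (root v))
  pendant-adj-root v k rewrite remQuot-combine {n} {suc r} v (suc k) | remQuot-combine {n} {suc r} v zero =
    from (T-=ᶠ {i = v}) refl

  pendant-onlyNeighbour : ∀ v k → OnlyNeighbour H (pendant v k) (root v)
  pendant-onlyNeighbour v k = ∀-combine {n} (suc r) adjacent⇒root
    where
    adjacent⇒root : ∀ (w : Fin n) t → T (H (pendant v k) (combine w t)) → combine w t ≡ root v
    adjacent⇒root w zero adj rewrite remQuot-combine {n} {suc r} v (suc k) | remQuot-combine {n} {suc r} w zero =
      cong root (sym (to (T-=ᶠ {i = v}) adj))
    adjacent⇒root w (suc t) adj rewrite remQuot-combine {n} {suc r} v (suc k) | remQuot-combine {n} {suc r} w (suc t) =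
      ⊥-elim adj

  labels≤2 : ∀ {i} {f : Fin (n * suc r) → Fin i} → Fin n → Fin r → IsDomaticLabelling H f → i ≤ 2
  labels≤2 v k d = onlyNeighbour⇒labels≤2 d (pendant-onlyNeighbour v k)

  isDomaticLabelling₂≡separatesRoot : Fin n → Fin r → (f : Fin (n * suc r) → Fin 2) →
    isDomaticLabelling H f ≡ allF {n} (λ v → separatesRoot (λ t → f (combine v t)))
  isDomaticLabelling₂≡separatesRoot v₀ k₀ f = T-injective (mk⇔
    (from T-separated ∘ necessary ∘ to T-isDomaticLabelling)
    (from T-isDomaticLabelling ∘ sufficient ∘ to T-separated))
    where
    Separated : Set
    Separated = ∀ v k → f (pendant v k) ≡ opposite (f (root v))

    T-separated : T (allF {n} (λ v → separatesRoot (λ t → f (combine v t)))) ⇔ Separated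
    T-separated = mk⇔
      (λ t v k → to (T-=ᶠ {i = f (pendant v k)}) (to T-allF (to T-allF t v) k))
      (λ s → from T-allF λ v → from T-allF λ k → from (T-=ᶠ {i = f (pendant v k)}) (s v k))

    necessary : IsDomaticLabelling H f → Separated
    necessary d v k = onlyNeighbour⇒opposite d (pendant-onlyNeighbour v k)

    sufficient : Separated → IsDomaticLabelling H f
    sufficient s = oppositeNeighbours⇒IsDomaticLabelling (root v₀) (∀-combine {n} (suc r) neighbour)
      where
      neighbour : ∀ (v : Fin n) t → ∃[ y ] T (H (combine v t) y) × f y ≡ opposite (f (combine v t))
      neighbour v zero    = pendant v k₀ , root-adj-pendant v k₀ , s v k₀
      neighbour v (suc k) = root v , pendant-adj-root v k , sym (trans (cong opposite (s v k)) (opposite-involutive _))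

  orderedDomatic-two : Fin n → Fin r → orderedDomatic (n * suc r) H 2 ≡ 2 ^ n
  orderedDomatic-two v₀ k₀ = begin
    orderedDomatic (n * suc r) H 2
      ≡⟨ orderedDomatic≡sumFuns _ H 2 ⟩
    sumFuns (n * suc r) 2 (indicator ∘ isDomaticLabelling H)
      ≡⟨ sumFuns-cong (cong indicator ∘ isDomaticLabelling₂≡separatesRoot v₀ k₀) ⟩
    sumFuns (n * suc r) 2 (λ f → indicator (allF {n} (λ v → separatesRoot (λ t → f (combine v t)))))
      ≡⟨ sumFuns-blockwise separatesRoot separatesRoot-ext n ⟩
    sumFuns (suc r) 2 (indicator ∘ separatesRoot) ^ n
      ≡⟨ cong (_^ n) (sumFuns-separatesRoot r) ⟩
    2 ^ n ∎

mainTheorem9 : (n r : ℕ) → 1 ≤ n → 0 < r → (G : SimpleGraph n) →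
    (i : ℕ) → dp (n * suc r) (coronaAdj r (adj G)) i ≡ rhsCoeff n i
mainTheorem9 zero    _       () _  _
mainTheorem9 (suc _) zero    _  () _
mainTheorem9 (suc n) (suc r) _  _  G = dp-values
  where
  open Corona (suc r) (adj G)

  dp-values : ∀ i → dp (suc n * suc (suc r)) H i ≡ rhsCoeff (suc n) i
  dp-values 0 = dp-none {A = H} (λ f _ → ¬Fin0 (f zero))
  dp-values 1 = cong (_/ 1) (trans (orderedDomatic-all {A = H} (singlePart-IsDomaticLabelling zero))
                                   (^-zeroˡ (suc n * suc (suc r))))
  dp-values 2 = trans (cong (_/ 2) (trans (orderedDomatic-two zero zero) (*-comm 2 (2 ^ n)))) (m*n/n≡m (2 ^ n) 2)
  dp-values (suc (suc (suc i))) = dp-none {A = H} (λ f d → ≤2-absurd (labels≤2 zero zero d))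
    where
    ≤2-absurd : ¬ 3 + i ≤ 2
    ≤2-absurd (s≤s (s≤s ()))
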